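{- Let $k,n$ be positive integers and let $T=(V,E)$ be a tree with $kn$ vertices. Then there exists at most one set $F\subseteq E$ of $k-1$ edges such that removing $F$ from $T$ creates $k$ connected components, each with exactly $n$ vertices. -}

module Defs where

open import Data.Nat using (ℕ; suc)
open import Data.Fin using (Fin; zero; suc; inject₁; fromℕ)
open import Data.Fin.Subset using (Subset; _∈_; _∉_; ⊤)
open import Data.Product using (Σ; ∃; ∃-syntax; _×_; _,_)
open import Data.Sum using (_⊎_)
open import Relation.Nullary using (¬_)
open import Relation.Binary.PropositionalEquality using (_≡_; _≢_)
open import Relation.Binary.Construct.Closure.ReflexiveTransitive using (Star)
open import Function.Definitions using (Injective)
open import Function.Bundles using (_⇔_)

-- A finite graph on vertex set Fin N with m edges, edge i joining the
-- endpoints (ends i).  Edges are indexed by Fin m, so edge subsets are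
-- Subset m and |F| is the cardinality of a Subset.
Ends : ℕ → ℕ → Set
Ends N m = Fin m → Fin N × Fin N

Joins : ∀ {N} → Fin N × Fin N → Fin N → Fin N → Set
Joins (a , b) u v = (a ≡ u × b ≡ v) ⊎ (a ≡ v × b ≡ u)

AdjIn : ∀ {N m} → Ends N m → Subset m → Fin N → Fin N → Set
AdjIn {m = m} e S u v = ∃[ i ] (i ∈ S × Joins (e i) u v)

AdjWithout : ∀ {N m} → Ends N m → Subset m → Fin N → Fin N → Set
AdjWithout {m = m} e F u v = ∃[ i ] (i ∉ F × Joins (e i) u v)

Adj : ∀ {N m} → Ends N m → Fin N → Fin N → Set
Adj e = AdjIn e ⊤

Simple : ∀ {N m} → Ends N m → Set
Simple {N} {m} e =
  (∀ (i : Fin m) u → ¬ Joins (e i) u u) ×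
  (∀ (i j : Fin m) u v → Joins (e i) u v → Joins (e j) u v → i ≡ j)

Connected : ∀ {N m} → Ends N m → Set
Connected {N} e = ∀ (u v : Fin N) → Star (Adj e) u v

-- a cycle: distinct vertices c_0, ..., c_{j+2} (at least 3), consecutive
-- ones adjacent, and c_{j+2} adjacent to c_0
Cycle : ∀ {N m} → Ends N m → Set
Cycle {N} e = ∃[ j ] Σ (Fin (suc (suc (suc j))) → Fin N) λ c →
  (Injective _≡_ _≡_ c ×
   (∀ (i : Fin (suc (suc j))) → Adj e (c (inject₁ i)) (c (suc i))) ×
   Adj e (c (fromℕ (suc (suc j)))) (c zero))

Acyclic : ∀ {N m} → Ends N m → Set
Acyclic e = ¬ Cycle e

IsTree : ∀ {N m} → Ends N m → Set
IsTree e = Simple e × Connected e × Acyclic e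

-- the component of v in a graph with adjacency R has exactly n vertices:
-- it is the image of an injective map Fin n → vertices
ComponentSize : ∀ {N} → (Fin N → Fin N → Set) → Fin N → ℕ → Set
ComponentSize {N} R v n =
  Σ (Fin n → Fin N) λ f → (Injective _≡_ _≡_ f ×
          (∀ (w : Fin N) → Star R v w ⇔ (∃[ i ] (f i ≡ w))))

-- the graph with adjacency R has exactly k connected components:
-- k pairwise non-connected representatives, every vertex connected to one
NumComponents : ∀ {N} → (Fin N → Fin N → Set) → ℕ → Set
NumComponents {N} R k =
  Σ (Fin k → Fin N) λ r →
    (∀ (i j : Fin k) → Star R (r i) (r j) → i ≡ j) ×
    (∀ (v : Fin N) → ∃[ i ] Star R (r i) v)

SplitsInto : ∀ {N m} → Ends N m → Subset m → ℕ → ℕ → Set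
SplitsInto {N} e F k n =
  NumComponents (AdjWithout e F) k ×
  (∀ (v : Fin N) → ComponentSize (AdjWithout e F) v n)

module Submission where

open import Defs
open import Data.Nat using (ℕ; zero; suc; _*_; _∸_; _+_; _≤_; _<_; _≥_; z≤n; s≤s; >-nonZero)
open import Data.Nat.Properties using (+-suc; +-comm; n≤1+n; ≤-trans)
open import Data.Nat.Divisibility using (_∣_; _∣0; ∣-refl; ∣m∣n⇒∣m+n; ∣m+n∣m⇒∣n; >⇒∤)
open import Data.Fin using (Fin; zero; suc; inject₁; fromℕ; _≟_)
open import Data.Fin.Properties using (any?; suc-injective; injective⇒≤)
open import Data.Fin.Subset
  using (Subset; outside; inside; ∣_∣; _∈_; _∉_; _⊆_; _⊂_; ⊥; ⁅_⁆; _∪_; _∩_; _─_)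
open import Data.Fin.Subset.Properties
  using ( _∈?_; ∈⊤; ∉⊥; x∈⁅x⁆; x∈⁅y⁆⇒x≡y; drop-not-there; ∣⊥∣≡0; ∪-identityˡ
        ; x∈p∪q⁺; x∈p∪q⁻; x∈p∩q⁺; x∈p∩q⁻; p∩q⊆q; x∈p∧x∉q⇒x∈p─q; p─q⊆p
        ; p∩q≢∅⇒p─q⊂p; p⊂q⇒∣p∣<∣q∣; ⊆-antisym; nonempty?; Empty-unique)
open import Data.Fin.Subset.Induction using (Acc; acc; ⊂-wellFounded)
open import Data.Vec using ([]; _∷_; here; there; tabulate)
open import Data.Vec.Properties using (lookup∘tabulate; []=⇒lookup; lookup⇒[]=)
open import Data.Product using (Σ; ∃; _×_; _,_; proj₁; proj₂)
import Data.Product as Product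
open import Data.Sum using (_⊎_; inj₁; inj₂; swap)
import Data.Empty as Empty
open import Level using (_⊔_)
open import Function using (_∘_; id)
open import Function.Bundles using (Equivalence)
open import Function.Definitions using (Injective)
open import Relation.Nullary using (¬_; Dec; yes; no; does; contradiction)
open import Relation.Nullary.Decidable using (map′; dec-true; dec-false; decidable-stable; _×-dec_; _⊎-dec_; ¬?)
open import Relation.Binary.Core using (Rel; _⇒_)
open import Relation.Binary.Definitions using (Decidable; DecidableEquality; Symmetric; _Respects_)
open import Relation.Binary.PropositionalEquality using (_≡_; refl; sym; trans; cong; subst)
open import Relation.Binary.Construct.Closure.ReflexiveTransitive
  using (Star; ε; _◅_; _◅◅_)

-- Suppose f ∈ F ∖ F′ and let a, b be its ends. In a forest f is a bridge, so
-- the set A of vertices reachable from a without using f misses b. A is a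
-- union of components of T − F, hence n ∣ |A|. Let C be the component of a in
-- T − F′; it contains b. The only edge of T − F′ leaving A is f, whose ends
-- both lie in C, so A ∖ C is a union of components of T − F′ and n ∣ |A ∖ C|.
-- Hence n ∣ |A ∩ C|, which is impossible as a ∈ A ∩ C ⊊ C and |C| = n.

∣p∣≡∣p∩q∣+∣p─q∣ : ∀ {N} (p q : Subset N) → ∣ p ∣ ≡ ∣ p ∩ q ∣ + ∣ p ─ q ∣
∣p∣≡∣p∩q∣+∣p─q∣ []            []            = refl
∣p∣≡∣p∩q∣+∣p─q∣ (inside  ∷ p) (inside  ∷ q) = cong suc (∣p∣≡∣p∩q∣+∣p─q∣ p q)
∣p∣≡∣p∩q∣+∣p─q∣ (inside  ∷ p) (outside ∷ q) = trans (cong suc (∣p∣≡∣p∩q∣+∣p─q∣ p q)) (sym (+-suc _ _))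
∣p∣≡∣p∩q∣+∣p─q∣ (outside ∷ p) (inside  ∷ q) = ∣p∣≡∣p∩q∣+∣p─q∣ p q
∣p∣≡∣p∩q∣+∣p─q∣ (outside ∷ p) (outside ∷ q) = ∣p∣≡∣p∩q∣+∣p─q∣ p q

x∈p─q⇒x∉q : ∀ {N} {x : Fin N} (p q : Subset N) → x ∈ p ─ q → x ∉ q
x∈p─q⇒x∉q (_ ∷ p) (outside ∷ q) (there x∈p─q) (there x∈q) = x∈p─q⇒x∉q p q x∈p─q x∈q
x∈p─q⇒x∉q (_ ∷ p) (inside  ∷ q) (there x∈p─q) (there x∈q) = x∈p─q⇒x∉q p q x∈p─q x∈q

x∈p⇒0<∣p∣ : ∀ {N} {x : Fin N} {p : Subset N} → x ∈ p → 0 < ∣ p ∣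
x∈p⇒0<∣p∣ {p = inside  ∷ _} _           = s≤s z≤n
x∈p⇒0<∣p∣ {p = outside ∷ _} (there x∈p) = x∈p⇒0<∣p∣ x∈p

∣⁅x⁆∪p∣≡1+∣p∣ : ∀ {N} {x : Fin N} {p : Subset N} → x ∉ p → ∣ ⁅ x ⁆ ∪ p ∣ ≡ suc ∣ p ∣
∣⁅x⁆∪p∣≡1+∣p∣ {x = zero}  {outside ∷ p} _   = cong (suc ∘ ∣_∣) (∪-identityˡ p)
∣⁅x⁆∪p∣≡1+∣p∣ {x = zero}  {inside  ∷ p} x∉p = contradiction here x∉p
∣⁅x⁆∪p∣≡1+∣p∣ {x = suc x} {outside ∷ p} x∉p = ∣⁅x⁆∪p∣≡1+∣p∣ (drop-not-there x∉p)
∣⁅x⁆∪p∣≡1+∣p∣ {x = suc x} {inside  ∷ p} x∉p = cong suc (∣⁅x⁆∪p∣≡1+∣p∣ (drop-not-there x∉p))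

image : ∀ {n N} → (Fin n → Fin N) → Subset N
image {zero}  f = ⊥
image {suc n} f = ⁅ f zero ⁆ ∪ image (f ∘ suc)

∈-image⁺ : ∀ {n N} (f : Fin n → Fin N) i → f i ∈ image f
∈-image⁺ f zero    = x∈p∪q⁺ (inj₁ (x∈⁅x⁆ (f zero)))
∈-image⁺ f (suc i) = x∈p∪q⁺ (inj₂ (∈-image⁺ (f ∘ suc) i))

∈-image⁻ : ∀ {n N} {x : Fin N} (f : Fin n → Fin N) → x ∈ image f → ∃ λ i → f i ≡ x
∈-image⁻ {zero}  f x∈ = contradiction x∈ ∉⊥
∈-image⁻ {suc n} f x∈ with x∈p∪q⁻ ⁅ f zero ⁆ (image (f ∘ suc)) x∈
... | inj₁ x∈⁅f0⁆ = zero , sym (x∈⁅y⁆⇒x≡y (f zero) x∈⁅f0⁆)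
... | inj₂ x∈im   = Product.map suc id (∈-image⁻ (f ∘ suc) x∈im)

∣image∣≡n : ∀ {n N} (f : Fin n → Fin N) → Injective _≡_ _≡_ f → ∣ image f ∣ ≡ n
∣image∣≡n {zero} {N} f _ = ∣⊥∣≡0 N
∣image∣≡n {suc n} f inj =
  trans (∣⁅x⁆∪p∣≡1+∣p∣ f0∉image) (cong suc (∣image∣≡n (f ∘ suc) (suc-injective ∘ inj)))
  where
  f0∉image : f zero ∉ image (f ∘ suc)
  f0∉image f0∈ with ∈-image⁻ (f ∘ suc) f0∈
  ... | i , fi≡f0 with inj fi≡f0
  ... | ()

respects-Star : ∀ {a ℓ p} {I : Set a} {R : Rel I ℓ} {P : I → Set p} → P Respects R → P Respects Star R
respects-Star resp ε        = id
respects-Star resp (r ◅ rs) = respects-Star resp rs ∘ resp r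

module _ {a ℓ} {I : Set a} {R : Rel I ℓ} where

  length : ∀ {x y} → Star R x y → ℕ
  length ε        = 0
  length (_ ◅ rs) = suc (length rs)

  vertex : ∀ {x y} (rs : Star R x y) → Fin (suc (length rs)) → I
  vertex {x} _ zero      = x
  vertex (_ ◅ rs) (suc i) = vertex rs i

  vertex-last : ∀ {x y} (rs : Star R x y) → vertex rs (fromℕ (length rs)) ≡ y
  vertex-last ε        = refl
  vertex-last (_ ◅ rs) = vertex-last rs

  vertex-step : ∀ {x y} (rs : Star R x y) (i : Fin (length rs)) →
                R (vertex rs (inject₁ i)) (vertex rs (suc i))
  vertex-step (r ◅ _)  zero    = r
  vertex-step (_ ◅ rs) (suc i) = vertex-step rs i

Path : ∀ {a ℓ} {I : Set a} → Rel I ℓ → Rel I (a ⊔ ℓ)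
Path R x y = Σ (Star R x y) λ rs → Injective _≡_ _≡_ (vertex rs)

module _ {a ℓ} {I : Set a} {R : Rel I ℓ} where

  suffix : ∀ {x y} ((rs , inj) : Path R x y) (i : Fin (suc (length rs))) → Path R (vertex rs i) y
  suffix p              zero    = p
  suffix (_ ◅ rs , inj) (suc i) = suffix (rs , suc-injective ∘ inj) i

  walk⇒path : DecidableEquality I → ∀ {x y} → Star R x y → Path R x y
  walk⇒path _≟ᵢ_ ε = ε , λ { {zero} {zero} _ → refl }
  walk⇒path _≟ᵢ_ {x} {y} (r ◅ rs) with walk⇒path _≟ᵢ_ rs
  ... | p , inj with any? (λ i → vertex p i ≟ᵢ x)
  ...   | yes (i , vi≡x) = subst (λ z → Path R z y) vi≡x (suffix (p , inj) i)
  ...   | no x∉p = r ◅ p , inj′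
    where
    inj′ : Injective _≡_ _≡_ (vertex (r ◅ p))
    inj′ {zero}  {zero}  _  = refl
    inj′ {zero}  {suc j} eq = contradiction (j , sym eq) x∉p
    inj′ {suc i} {zero}  eq = contradiction (i , eq) x∉p
    inj′ {suc i} {suc j} eq = cong suc (inj eq)

module _ {N ℓ} {R : Rel (Fin N) ℓ} (R? : Decidable R) where

  walk≤? : ∀ k x y → Dec (Σ (Star R x y) λ rs → length rs ≤ k)
  walk≤? zero x y =
    map′ (λ { refl → ε , z≤n }) (λ { (ε , _) → refl ; (_ ◅ _ , ()) }) (x ≟ y)
  walk≤? (suc k) x y with x ≟ y
  ... | yes refl = yes (ε , z≤n)
  ... | no x≢y   = map′ (λ (_ , r , rs , rs≤k) → r ◅ rs , s≤s rs≤k) firstStep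
                        (any? λ z → R? x z ×-dec walk≤? k z y)
    where
    firstStep : Σ (Star R x y) (λ rs → length rs ≤ suc k) →
                ∃ λ z → R x z × Σ (Star R z y) λ rs → length rs ≤ k
    firstStep (ε , _)              = contradiction refl x≢y
    firstStep (r ◅ rs , s≤s rs≤k) = _ , r , rs , rs≤k

  -- reachability is decided by the walks of length at most N, which include all paths
  Star? : Decidable (Star R)
  Star? x y = map′ proj₁ shortWalk (walk≤? N x y)
    where
    shortWalk : Star R x y → Σ (Star R x y) λ rs → length rs ≤ N
    shortWalk rs with walk⇒path _≟_ rs
    ... | p , inj = p , ≤-trans (n≤1+n _) (injective⇒≤ inj)

  reachable : Fin N → Subset N
  reachable x = tabulate (does ∘ Star? x)

  ∈-reachable⁺ : ∀ {x y} → Star R x y → y ∈ reachable x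
  ∈-reachable⁺ {x} {y} rs =
    lookup⇒[]= y _ (trans (lookup∘tabulate _ y) (dec-true (Star? x y) rs))

  ∈-reachable⁻ : ∀ {x y} → y ∈ reachable x → Star R x y
  ∈-reachable⁻ {x} {y} y∈ = decidable-stable (Star? x y) λ ¬rs →
    contradiction (trans (sym (dec-false (Star? x y) ¬rs)) (trans (sym (lookup∘tabulate _ y)) ([]=⇒lookup y∈)))
                  λ ()

  reachable-respects : ∀ x → (_∈ reachable x) Respects R
  reachable-respects x r y∈ = ∈-reachable⁺ (∈-reachable⁻ y∈ ◅◅ (r ◅ ε))

module Components {N} {R : Fin N → Fin N → Set} (R-sym : Symmetric R)
                  {n} (size : ∀ v → ComponentSize R v n) where

  component : Fin N → Subset N
  component v = image (proj₁ (size v))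

  ∣component∣≡n : ∀ v → ∣ component v ∣ ≡ n
  ∣component∣≡n v = ∣image∣≡n (proj₁ (size v)) (proj₁ (proj₂ (size v)))

  ∈-component⁺ : ∀ {v w} → Star R v w → w ∈ component v
  ∈-component⁺ {v} {w} rs with Equivalence.to (proj₂ (proj₂ (size v)) w) rs
  ... | i , refl = ∈-image⁺ (proj₁ (size v)) i

  ∈-component⁻ : ∀ {v w} → w ∈ component v → Star R v w
  ∈-component⁻ {v} {w} w∈ =
    Equivalence.from (proj₂ (proj₂ (size v)) w) (∈-image⁻ (proj₁ (size v)) w∈)

  ∉-component-respects : ∀ v → (_∉ component v) Respects R
  ∉-component-respects v r u∉ w∈ = u∉ (∈-component⁺ (∈-component⁻ w∈ ◅◅ (R-sym r ◅ ε)))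

  closed⇒divisible : ∀ A → (_∈ A) Respects R → n ∣ ∣ A ∣
  closed⇒divisible A = go A (⊂-wellFounded A)
    where
    go : ∀ A → Acc _⊂_ A → (_∈ A) Respects R → n ∣ ∣ A ∣
    go A (acc smaller) closed with nonempty? A
    ... | no empty = subst (n ∣_) (sym (trans (cong ∣_∣ (Empty-unique empty)) (∣⊥∣≡0 N))) (n ∣0)
    ... | yes (v , v∈A) =
      subst (n ∣_) (sym ∣A∣≡n+∣A─C∣)
        (∣m∣n⇒∣m+n ∣-refl
                   (go (A ─ C) (smaller (p∩q≢∅⇒p─q⊂p A C (v , x∈p∩q⁺ (v∈A , v∈C)))) A─C-closed))
      where
      C = component v
      v∈C : v ∈ C
      v∈C = ∈-component⁺ ε
      C⊆A : C ⊆ A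
      C⊆A w∈C = respects-Star closed (∈-component⁻ w∈C) v∈A
      ∣A∣≡n+∣A─C∣ : ∣ A ∣ ≡ n + ∣ A ─ C ∣
      ∣A∣≡n+∣A─C∣ = trans (∣p∣≡∣p∩q∣+∣p─q∣ A C)
        (cong (_+ ∣ A ─ C ∣) (trans (cong ∣_∣ (⊆-antisym (p∩q⊆q A C) (λ w∈C → x∈p∩q⁺ (C⊆A w∈C , w∈C))))
                                    (∣component∣≡n v)))
      A─C-closed : (_∈ A ─ C) Respects R
      A─C-closed r u∈ = x∈p∧x∉q⇒x∈p─q (closed r (p─q⊆p A C u∈))
                                       (∉-component-respects v r (x∈p─q⇒x∉q A C u∈))

joins-sym : ∀ {N} (p : Fin N × Fin N) {u v} → Joins p u v → Joins p v u
joins-sym _ = swap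

joins-end : ∀ {N} (p : Fin N × Fin N) {u v} → Joins p u v → u ≡ proj₁ p ⊎ u ≡ proj₂ p
joins-end _ (inj₁ (p₁≡u , _)) = inj₁ (sym p₁≡u)
joins-end _ (inj₂ (_ , p₂≡u)) = inj₂ (sym p₂≡u)

joins? : ∀ {N} (p : Fin N × Fin N) u v → Dec (Joins p u v)
joins? (x , y) u v = ((x ≟ u) ×-dec (y ≟ v)) ⊎-dec ((x ≟ v) ×-dec (y ≟ u))

module _ {N m} (e : Ends N m) where

  AdjWithout-sym : ∀ F → Symmetric (AdjWithout e F)
  AdjWithout-sym F (j , j∉F , J) = j , j∉F , joins-sym (e j) J

  AdjWithout? : ∀ F → Decidable (AdjWithout e F)
  AdjWithout? F u v = any? λ j → ¬? (j ∈? F) ×-dec joins? (e j) u v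

  AdjWithout-antitone : ∀ {F G} → F ⊆ G → AdjWithout e G ⇒ AdjWithout e F
  AdjWithout-antitone F⊆G (j , j∉G , J) = j , j∉G ∘ F⊆G , J

  AdjWithout⇒Adj : ∀ {F} → AdjWithout e F ⇒ Adj e
  AdjWithout⇒Adj (j , _ , J) = j , ∈⊤ , J

module _ {N m} {e : Ends N m} (simple : Simple e) (acyclic : Acyclic e) where

  -- a path of length 0, 1 or ≥ 2 closes up with f into a loop, a parallel edge or a cycle
  ¬path-between-ends : ∀ f {u v} → Joins (e f) u v → ¬ Path (AdjWithout e ⁅ f ⁆) u v
  ¬path-between-ends f J (ε , _) = proj₁ simple f _ J
  ¬path-between-ends f J ((j , j∉⁅f⁆ , J′) ◅ ε , _) =
    j∉⁅f⁆ (subst (_∈ ⁅ f ⁆) (sym (proj₂ simple j f _ _ J′ J)) (x∈⁅x⁆ f))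
  ¬path-between-ends f J (rs@(_ ◅ _ ◅ rs′) , inj) =
    acyclic ( length rs′ , vertex rs , inj , (λ i → AdjWithout⇒Adj e (vertex-step rs i))
            , subst (λ z → Adj e z _) (sym (vertex-last rs)) (f , ∈⊤ , joins-sym (e f) J))

  edge-is-bridge : ∀ f → ¬ Star (AdjWithout e ⁅ f ⁆) (proj₁ (e f)) (proj₂ (e f))
  edge-is-bridge f = ¬path-between-ends f (inj₁ (refl , refl)) ∘ walk⇒path _≟_

  module _ {n} {F F′ : Subset m}
           (sizeF : ∀ v → ComponentSize (AdjWithout e F) v n)
           (sizeF′ : ∀ v → ComponentSize (AdjWithout e F′) v n) where

    private
      module CompF  = Components (AdjWithout-sym e F) sizeF
      module CompF′ = Components (AdjWithout-sym e F′) sizeF′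

    module _ {f} (f∈F : f ∈ F) (f∉F′ : f ∉ F′) where

      private
        a b : Fin N
        a = proj₁ (e f)
        b = proj₂ (e f)

        A C : Subset N
        A = reachable (AdjWithout? e ⁅ f ⁆) a
        C = CompF′.component a

        b∉A : b ∉ A
        b∉A = edge-is-bridge f ∘ ∈-reachable⁻ _

        a∈A∩C : a ∈ A ∩ C
        a∈A∩C = x∈p∩q⁺ (∈-reachable⁺ _ ε , CompF′.∈-component⁺ ε)

        b∈C : b ∈ C
        b∈C = CompF′.∈-component⁺ ((f , f∉F′ , inj₁ (refl , refl)) ◅ ε)

        n∣∣A∣ : n ∣ ∣ A ∣
        n∣∣A∣ = CompF.closed⇒divisible A λ r → reachable-respects _ a (AdjWithout-antitone e ⁅f⁆⊆F r)
          where
          ⁅f⁆⊆F : ⁅ f ⁆ ⊆ F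
          ⁅f⁆⊆F x∈⁅f⁆ = subst (_∈ F) (sym (x∈⁅y⁆⇒x≡y f x∈⁅f⁆)) f∈F

        A─C-closed : (_∈ A ─ C) Respects AdjWithout e F′
        A─C-closed r@(j , _ , J) u∈A─C with j ≟ f
        ... | yes refl = contradiction (end∈C (joins-end (e f) J)) (x∈p─q⇒x∉q A C u∈A─C)
          where
          end∈C : ∀ {u} → u ≡ a ⊎ u ≡ b → u ∈ C
          end∈C (inj₁ refl) = proj₂ (x∈p∩q⁻ A C a∈A∩C)
          end∈C (inj₂ refl) = b∈C
        ... | no j≢f = x∈p∧x∉q⇒x∈p─q
          (reachable-respects _ a (j , j≢f ∘ x∈⁅y⁆⇒x≡y f , J) (p─q⊆p A C u∈A─C))
          (CompF′.∉-component-respects a r (x∈p─q⇒x∉q A C u∈A─C))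

        n∣∣A∩C∣ : n ∣ ∣ A ∩ C ∣
        n∣∣A∩C∣ = ∣m+n∣m⇒∣n (subst (n ∣_) (trans (∣p∣≡∣p∩q∣+∣p─q∣ A C) (+-comm ∣ A ∩ C ∣ ∣ A ─ C ∣)) n∣∣A∣)
                             (CompF′.closed⇒divisible (A ─ C) A─C-closed)

        ∣A∩C∣<n : ∣ A ∩ C ∣ < n
        ∣A∩C∣<n = subst (∣ A ∩ C ∣ <_) (CompF′.∣component∣≡n a)
                        (p⊂q⇒∣p∣<∣q∣ (p∩q⊆q A C , b , b∈C , b∉A ∘ proj₁ ∘ x∈p∩q⁻ A C))

      ∈F⇒¬∉F′ : Empty.⊥
      ∈F⇒¬∉F′ = >⇒∤ {{>-nonZero (x∈p⇒0<∣p∣ a∈A∩C)}} ∣A∩C∣<n n∣∣A∩C∣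

    same-component-size⇒⊆ : F ⊆ F′
    same-component-size⇒⊆ {f} f∈F = decidable-stable (f ∈? F′) (∈F⇒¬∉F′ f∈F)

lemma1 : (k n : ℕ) → k ≥ 1 → n ≥ 1 → (m : ℕ) → (e : Ends (k * n) m) →
         IsTree e →
         (F F′ : Subset m) →
         ∣ F ∣ ≡ k ∸ 1 → SplitsInto e F k n →
         ∣ F′ ∣ ≡ k ∸ 1 → SplitsInto e F′ k n →
         F ≡ F′
lemma1 _ _ _ _ _ _ (simple , _ , acyclic) _ _ _ (_ , sizeF) _ (_ , sizeF′) =
  ⊆-antisym (same-component-size⇒⊆ simple acyclic sizeF sizeF′)
            (same-component-size⇒⊆ simple acyclic sizeF′ sizeF)
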